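{- Let $N$ be a positive integer and let $X$ and $Y$ be two word sets which are (similar to) $N$-block presentations. If $X\succcurlyeq Y$, then $X^{[-N]}\succcurlyeq Y^{[-N]}$, where $X^{[-N]}$ and $Y^{[-N]}$ denote the maximal $N$-preimages of $X$ and $Y$ respectively.
   Context: Words over a finite alphabet may be finite, infinite or bi-infinite; a word set is any set of such words. A projection is a map between alphabets extended letter by letter to words; $X\succcurlyeq Y$ means $\varphi(X)=Y$ for some projection $\varphi$; $X\sim Y$ (similar) means $X\succcurlyeq Y$ and $Y\succcurlyeq X$. The $N$-block presentation $W^{[N]}$ of a word set $W$ (all of whose words have length at least $N$) replaces each word $u$ by the word whose $i$-th letter is the block $[u_iu_{i+1}\dots u_{i+N-1}]$. A word set $Z$ is an $N$-block presentation if $Z\sim W^{[N]}$ for some word set $W$; such a $W$ is an $N$-preimage of $Z$. The maximal $N$-preimage $Z^{[-N]}$ of an $N$-block presentation $Z$ is an $N$-preimage of $Z$ such that $Z^{[-N]}\succcurlyeq W$ for every $N$-preimage $W$ of $Z$; it exists and is unique up to similarity. -}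

module Defs where

open import Level using (Level; _⊔_) renaming (suc to lsuc)
open import Data.Nat using (ℕ; zero; suc; _+_; _≤_)
open import Data.Integer as ℤ using (ℤ; +_)
open import Data.Fin using (Fin; toℕ)
open import Data.List as List using (List; []; _∷_; length)
open import Data.Vec as Vec using (Vec; []; _∷_; tabulate)
open import Data.Maybe as Maybe using (Maybe; just; nothing)
open import Data.Product using (Σ; ∃; ∃-syntax; _×_; _,_)
open import Data.Unit using (⊤)
open import Data.Empty using (⊥)
open import Function.Bundles using (_↔_)
open import Relation.Binary.PropositionalEquality using (_≡_)

data Word (A : Set) : Set where
  fin : List A → Word A
  inf : (ℕ → A) → Word A
  bi  : (ℤ → A) → Word A

_≈_ : {A : Set} → Word A → Word A → Set
fin u ≈ fin v = u ≡ v
inf f ≈ inf g = ∀ i → f i ≡ g i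
bi f  ≈ bi g  = ∀ i → f i ≡ g i
_     ≈ _     = ⊥

mapW : {A B : Set} → (A → B) → Word A → Word B
mapW φ (fin u) = fin (List.map φ u)
mapW φ (inf f) = inf (λ i → φ (f i))
mapW φ (bi f)  = bi (λ i → φ (f i))

LengthAtLeast : {A : Set} → ℕ → Word A → Set
LengthAtLeast N (fin u) = N ≤ length u
LengthAtLeast N (inf _) = ⊤
LengthAtLeast N (bi _)  = ⊤

window : {A : Set} (N : ℕ) → List A → Maybe (Vec A N)
window zero    _        = just []
window (suc N) []       = nothing
window (suc N) (x ∷ xs) = Maybe.map (x ∷_) (window N xs)

blocksL : {A : Set} (N : ℕ) → List A → List (Vec A N)
blocksL N []       = []
blocksL N (x ∷ xs) with window N (x ∷ xs)
... | just v  = v ∷ blocksL N xs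
... | nothing = []

block : {A : Set} (N : ℕ) → Word A → Word (Vec A N)
block N (fin u) = fin (blocksL N u)
block N (inf f) = inf (λ i → tabulate (λ j → f (i + toℕ j)))
block N (bi f)  = bi (λ i → tabulate (λ j → f (i ℤ.+ + toℕ j)))

WordPred : Set → Set₁
WordPred A = Word A → Set

-- φ(X) = Y, as sets of words (words identified up to _≈_).
ProjectsOnto : {A B : Set} → (A → B) → WordPred A → WordPred B → Set
ProjectsOnto φ X Y =
  (∀ u → X u → ∃[ w ] (Y w × mapW φ u ≈ w)) ×
  (∀ w → Y w → ∃[ u ] (X u × mapW φ u ≈ w))

Dominates : {A B : Set} → WordPred A → WordPred B → Set
Dominates {A} {B} X Y = Σ (A → B) λ φ → ProjectsOnto φ X Y

record WordSet : Set₁ where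
  field
    Alpha  : Set
    finite : Σ ℕ λ n → Alpha ↔ Fin n
    words  : WordPred Alpha
open WordSet public

_≽_ : WordSet → WordSet → Set
X ≽ Y = Dominates (words X) (words Y)

_∼_ : WordSet → WordSet → Set
X ∼ Y = (X ≽ Y) × (Y ≽ X)

blockSet : (N : ℕ) (W : WordSet) → WordPred (Vec (Alpha W) N)
blockSet N W z = ∃[ u ] (words W u × block N u ≈ z)

IsPreimage : ℕ → WordSet → WordSet → Set
IsPreimage N Z W =
  (∀ u → words W u → LengthAtLeast N u) ×
  Dominates (words Z) (blockSet N W) ×
  Dominates (blockSet N W) (words Z)

IsBlockPresentation : ℕ → WordSet → Set₁
IsBlockPresentation N Z = Σ WordSet λ W → IsPreimage N Z W

IsMaxPreimage : ℕ → WordSet → WordSet → Set₁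
IsMaxPreimage N Z M = IsPreimage N Z M × (∀ W → IsPreimage N Z W → M ≽ W)

module Submission where

-- Let MX = X^[-N] and MY = Y^[-N].  Composing the similarities
-- MX^[N] ∼ X and MY^[N] ∼ Y with X ≽ Y gives a letter map g on N-blocks
-- with g(MX^[N]) = MY^[N].  From g we build the *graph* word set W over
-- the alphabet Alpha MX × Alpha MY: it consists of the zipped words
-- (m′, m) with m′ ∈ MX, m ∈ MY and m^[N] = g(m′^[N]).  Since N ≥ 1 such
-- partners have the same length, so
--   * the N-blocks of (m′, m) are the blocks of m′ paired with their g-images,
--     hence W^[N] ∼ MX^[N] ∼ X, i.e. W is an N-preimage of X;
--   * the second projection maps W onto MY.
-- Maximality of MX gives MX ≽ W, and transitivity of ≽ gives MX ≽ MY.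

open import Defs
open import Data.Nat using (ℕ; zero; suc; pred; _+_; _*_; _≤_; _<_; _≥_; _⊓_; s≤s; s≤s⁻¹; _≤?_)
open import Data.Nat.Properties using (≤-antisym; ≰⇒>; ⊓-idem)
open import Data.Fin using (Fin)
open import Data.Fin.Properties using (*↔×)
open import Data.List as L using (List; []; _∷_; length)
open import Data.List.Properties using (map-∘; map-id; map-cong; length-map; length-zipWith; zipWith-zeroʳ)
open import Data.Vec as V using (Vec; tabulate)
open import Data.Vec.Properties using (map-proj₁-zip)
open import Data.Maybe as M using (Maybe; just; nothing)
open import Data.Product using (Σ; ∃-syntax; _×_; _,_; proj₁; proj₂)
open import Relation.Nullary using (yes; no)
open import Function.Bundles using (_↔_)
open import Function.Properties.Inverse using (↔-trans; ↔-sym)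
open import Data.Product.Function.NonDependent.Propositional using (_×-↔_)
open import Relation.Binary.PropositionalEquality
open ≡-Reasoning

≈-refl : {A : Set} (u : Word A) → u ≈ u
≈-refl (fin u) = refl
≈-refl (inf f) = λ i → refl
≈-refl (bi f)  = λ i → refl

≈-sym : {A : Set} {u v : Word A} → u ≈ v → v ≈ u
≈-sym {u = fin _} {fin _} p = sym p
≈-sym {u = inf _} {inf _} p = λ i → sym (p i)
≈-sym {u = bi _}  {bi _}  p = λ i → sym (p i)
≈-sym {u = fin _} {inf _} ()
≈-sym {u = fin _} {bi _}  ()
≈-sym {u = inf _} {fin _} ()
≈-sym {u = inf _} {bi _}  ()
≈-sym {u = bi _}  {fin _} ()
≈-sym {u = bi _}  {inf _} ()

≈-trans : {A : Set} {u v w : Word A} → u ≈ v → v ≈ w → u ≈ w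
≈-trans {u = fin _} {fin _} {fin _} p q = trans p q
≈-trans {u = inf _} {inf _} {inf _} p q = λ i → trans (p i) (q i)
≈-trans {u = bi _}  {bi _}  {bi _}  p q = λ i → trans (p i) (q i)
≈-trans {u = fin _} {fin _} {inf _} _ ()
≈-trans {u = fin _} {fin _} {bi _}  _ ()
≈-trans {u = inf _} {inf _} {fin _} _ ()
≈-trans {u = inf _} {inf _} {bi _}  _ ()
≈-trans {u = bi _}  {bi _}  {fin _} _ ()
≈-trans {u = bi _}  {bi _}  {inf _} _ ()
≈-trans {u = fin _} {inf _} ()
≈-trans {u = fin _} {bi _}  ()
≈-trans {u = inf _} {fin _} ()
≈-trans {u = inf _} {bi _}  ()
≈-trans {u = bi _}  {fin _} ()
≈-trans {u = bi _}  {inf _} ()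

mapW-cong : {A B : Set} (f : A → B) {u v : Word A} → u ≈ v → mapW f u ≈ mapW f v
mapW-cong f {fin _} {fin _} p = cong (L.map f) p
mapW-cong f {inf _} {inf _} p = λ i → cong f (p i)
mapW-cong f {bi _}  {bi _}  p = λ i → cong f (p i)
mapW-cong f {fin _} {inf _} ()
mapW-cong f {fin _} {bi _}  ()
mapW-cong f {inf _} {fin _} ()
mapW-cong f {inf _} {bi _}  ()
mapW-cong f {bi _}  {fin _} ()
mapW-cong f {bi _}  {inf _} ()

mapW-∘ : {A B C : Set} (g : B → C) (f : A → B) (u : Word A) →
         mapW (λ a → g (f a)) u ≈ mapW g (mapW f u)
mapW-∘ g f (fin u) = map-∘ u
mapW-∘ g f (inf _) = λ i → refl
mapW-∘ g f (bi _)  = λ i → refl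

mapW-id : {A : Set} (f : A → A) → (∀ a → f a ≡ a) → (u : Word A) → mapW f u ≈ u
mapW-id f f≗id (fin u) = trans (map-cong f≗id u) (map-id u)
mapW-id f f≗id (inf h) = λ i → f≗id (h i)
mapW-id f f≗id (bi h)  = λ i → f≗id (h i)

dominates-trans : {A B C : Set} {X : WordPred A} {Y : WordPred B} {Z : WordPred C} →
                  Dominates X Y → Dominates Y Z → Dominates X Z
dominates-trans {X = X} {Y} {Z} (φ , φ-into , φ-onto) (ψ , ψ-into , ψ-onto) =
  (λ a → ψ (φ a)) , into , onto
  where
  into : ∀ u → X u → ∃[ z ] (Z z × mapW (λ a → ψ (φ a)) u ≈ z)
  into u Xu with φ-into u Xu
  ... | w , Yw , φu≈w with ψ-into w Yw
  ... | z , Zz , ψw≈z = z , Zz , ≈-trans (mapW-∘ ψ φ u) (≈-trans (mapW-cong ψ φu≈w) ψw≈z)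
  onto : ∀ z → Z z → ∃[ u ] (X u × mapW (λ a → ψ (φ a)) u ≈ z)
  onto z Zz with ψ-onto z Zz
  ... | w , Yw , ψw≈z with φ-onto w Yw
  ... | u , Xu , φu≈w = u , Xu , ≈-trans (mapW-∘ ψ φ u) (≈-trans (mapW-cong ψ φu≈w) ψw≈z)

finite-× : {A B : Set} → (Σ ℕ λ n → A ↔ Fin n) → (Σ ℕ λ n → B ↔ Fin n) →
           Σ ℕ λ n → (A × B) ↔ Fin n
finite-× (a , A↔a) (b , B↔b) = a * b , ↔-trans (A↔a ×-↔ B↔b) (↔-sym *↔×)

-- Letterwise pairing of two words of the same kind (a placeholder otherwise).
zipW : {A B : Set} → Word A → Word B → Word (A × B)
zipW (fin u) (fin v) = fin (L.zip u v)
zipW (inf f) (inf g) = inf (λ i → f i , g i)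
zipW (bi f)  (bi g)  = bi (λ i → f i , g i)
zipW _       _       = fin []

data Aligned {A B : Set} : Word A → Word B → Set where
  fin : {u : List A} {v : List B} → length u ≡ length v → Aligned (fin u) (fin v)
  inf : {f : ℕ → A} {g : ℕ → B} → Aligned (inf f) (inf g)
  bi  : {f : _ → A} {g : _ → B} → Aligned (bi f) (bi g)

proj₂-zip : {A B : Set} (u : List A) (v : List B) → length u ≡ length v →
            L.map proj₂ (L.zip u v) ≡ v
proj₂-zip []      []      _       = refl
proj₂-zip (x ∷ u) (y ∷ v) |u|≡|v| = cong (y ∷_) (proj₂-zip u v (cong pred |u|≡|v|))

proj₂-zipW : {A B : Set} {u : Word A} {v : Word B} → Aligned u v → mapW proj₂ (zipW u v) ≈ v
proj₂-zipW {u = fin u} {fin v} (fin |u|≡|v|) = proj₂-zip u v |u|≡|v|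
proj₂-zipW inf = λ i → refl
proj₂-zipW bi  = λ i → refl

length-zip : {A B : Set} (u : List A) (v : List B) → length u ≡ length v →
             length (L.zip u v) ≡ length u
length-zip u v |u|≡|v| = begin
  length (L.zip u v)      ≡⟨ length-zipWith _,_ u v ⟩
  length u ⊓ length v     ≡⟨ cong (length u ⊓_) (sym |u|≡|v|) ⟩
  length u ⊓ length u     ≡⟨ ⊓-idem (length u) ⟩
  length u                ∎

zipW-long : {A B : Set} {N : ℕ} {u : Word A} {v : Word B} → Aligned u v →
            LengthAtLeast N u → LengthAtLeast N (zipW u v)
zipW-long {N = N} {fin u} {fin v} (fin |u|≡|v|) long =
  subst (N ≤_) (sym (length-zip u v |u|≡|v|)) long
zipW-long inf _ = _
zipW-long bi  _ = _

window-zip : {A B : Set} (N : ℕ) (u : List A) (v : List B) →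
             window N (L.zip u v) ≡ M.zipWith V.zip (window N u) (window N v)
window-zip zero    u        v        = refl
window-zip (suc N) []       v        = refl
window-zip (suc N) (x ∷ xs) []       with window N xs
... | just _  = refl
... | nothing = refl
window-zip (suc N) (x ∷ xs) (y ∷ ys) rewrite window-zip N xs ys with window N xs | window N ys
... | just _  | just _  = refl
... | just _  | nothing = refl
... | nothing | _       = refl

consBlock : {A : Set} → Maybe A → List A → List A
consBlock (just v) l = v ∷ l
consBlock nothing  l = []

blocksL-∷ : {A : Set} (N : ℕ) (x : A) (xs : List A) →
            blocksL N (x ∷ xs) ≡ consBlock (window N (x ∷ xs)) (blocksL N xs)
blocksL-∷ N x xs with window N (x ∷ xs)
... | just _  = refl
... | nothing = refl

consBlock-zipWith : {A B C : Set} (f : A → B → C) (a : Maybe A) (b : Maybe B) (l : List A) (k : List B) →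
                    consBlock (M.zipWith f a b) (L.zipWith f l k) ≡ L.zipWith f (consBlock a l) (consBlock b k)
consBlock-zipWith f (just _) (just _) l k = refl
consBlock-zipWith f (just _) nothing  l k = refl
consBlock-zipWith f nothing  _        l k = refl

blocksL-zip : {A B : Set} (N : ℕ) (u : List A) (v : List B) →
              blocksL N (L.zip u v) ≡ L.zipWith V.zip (blocksL N u) (blocksL N v)
blocksL-zip N []       v        = refl
blocksL-zip N (x ∷ xs) []       = sym (zipWith-zeroʳ V.zip (blocksL N (x ∷ xs)))
blocksL-zip N (x ∷ xs) (y ∷ ys) = begin
  blocksL N (L.zip (x ∷ xs) (y ∷ ys))
    ≡⟨ blocksL-∷ N (x , y) (L.zip xs ys) ⟩
  consBlock (window N (L.zip (x ∷ xs) (y ∷ ys))) (blocksL N (L.zip xs ys))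
    ≡⟨ cong₂ consBlock (window-zip N (x ∷ xs) (y ∷ ys)) (blocksL-zip N xs ys) ⟩
  consBlock (M.zipWith V.zip (window N (x ∷ xs)) (window N (y ∷ ys)))
            (L.zipWith V.zip (blocksL N xs) (blocksL N ys))
    ≡⟨ consBlock-zipWith V.zip (window N (x ∷ xs)) (window N (y ∷ ys)) (blocksL N xs) (blocksL N ys) ⟩
  L.zipWith V.zip (consBlock (window N (x ∷ xs)) (blocksL N xs))
                  (consBlock (window N (y ∷ ys)) (blocksL N ys))
    ≡⟨ sym (cong₂ (L.zipWith V.zip) (blocksL-∷ N x xs) (blocksL-∷ N y ys)) ⟩
  L.zipWith V.zip (blocksL N (x ∷ xs)) (blocksL N (y ∷ ys)) ∎

tabulate-pair : {A B : Set} (N : ℕ) (f : Fin N → A) (h : Fin N → B) →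
                tabulate (λ j → f j , h j) ≡ V.zip (tabulate f) (tabulate h)
tabulate-pair zero    f h = refl
tabulate-pair (suc N) f h = cong (_ V.∷_) (tabulate-pair N (λ j → f (Fin.suc j)) (λ j → h (Fin.suc j)))

zipWith-diagonal : {A B C : Set} (f : A → B → C) (g : A → B) (l : List A) →
                   L.zipWith f l (L.map g l) ≡ L.map (λ a → f a (g a)) l
zipWith-diagonal f g []      = refl
zipWith-diagonal f g (x ∷ l) = cong (_ ∷_) (zipWith-diagonal f g l)

BlockImage : {A B : Set} (N : ℕ) → (Vec A N → Vec B N) → Word A → Word B → Set
BlockImage N g m′ m = block N m ≈ mapW g (block N m′)

pairWith : {A B : Set} {N : ℕ} → (Vec A N → Vec B N) → Vec A N → Vec (A × B) N
pairWith g p = V.zip p (g p)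

block-zipW : {A B : Set} (N : ℕ) (g : Vec A N → Vec B N) {m′ : Word A} {m : Word B} →
             Aligned m′ m → BlockImage N g m′ m →
             block N (zipW m′ m) ≈ mapW (pairWith g) (block N m′)
block-zipW N g {fin u} {fin v} (fin _) image = begin
  blocksL N (L.zip u v)                                ≡⟨ blocksL-zip N u v ⟩
  L.zipWith V.zip (blocksL N u) (blocksL N v)          ≡⟨ cong (L.zipWith V.zip (blocksL N u)) image ⟩
  L.zipWith V.zip (blocksL N u) (L.map g (blocksL N u)) ≡⟨ zipWith-diagonal V.zip g (blocksL N u) ⟩
  L.map (pairWith g) (blocksL N u)                     ∎
block-zipW N g inf image = λ i → trans (tabulate-pair N _ _) (cong (V.zip _) (image i))
block-zipW N g bi  image = λ i → trans (tabulate-pair N _ _) (cong (V.zip _) (image i))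

unpair-pair : {A B : Set} {N : ℕ} (g : Vec A N → Vec B N) (u : Word (Vec A N)) →
              mapW (V.map proj₁) (mapW (pairWith g) u) ≈ u
unpair-pair g u =
  ≈-trans (≈-sym (mapW-∘ (V.map proj₁) (pairWith g) u)) (mapW-id _ (λ p → map-proj₁-zip p (g p)) u)

window-just : {A : Set} (N : ℕ) (u : List A) → N ≤ length u → ∃[ v ] (window N u ≡ just v)
window-just zero    u        _         = V.[] , refl
window-just (suc N) (x ∷ xs) (s≤s long) with window-just N xs long
... | v , eq rewrite eq = x V.∷ v , refl

window-nothing : {A : Set} (N : ℕ) (u : List A) → length u < N → window N u ≡ nothing
window-nothing (suc N) []       _          = refl
window-nothing (suc N) (x ∷ xs) (s≤s short) rewrite window-nothing N xs short = refl

blocksL-short : {A : Set} (N : ℕ) (u : List A) → length u < N → blocksL N u ≡ []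
blocksL-short N []       _     = refl
blocksL-short N (x ∷ xs) short rewrite blocksL-∷ N x xs | window-nothing N (x ∷ xs) short = refl

length-blocksL : {A : Set} (n : ℕ) (u : List A) → suc n ≤ length u →
                 length (blocksL (suc n) u) + n ≡ length u
length-blocksL n (x ∷ xs) long with window-just (suc n) (x ∷ xs) long
... | v , eq rewrite blocksL-∷ (suc n) x xs | eq with suc n ≤? length xs
...   | yes long′ = cong suc (length-blocksL n xs long′)
...   | no  short rewrite blocksL-short (suc n) xs (≰⇒> short) =
  cong suc (≤-antisym (s≤s⁻¹ long) (s≤s⁻¹ (≰⇒> short)))

blockImage-length : {A B : Set} (n : ℕ) (g : Vec A (suc n) → Vec B (suc n)) (u : List A) (v : List B) →
                    suc n ≤ length u → suc n ≤ length v →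
                    blocksL (suc n) v ≡ L.map g (blocksL (suc n) u) → length u ≡ length v
blockImage-length n g u v long-u long-v image = begin
  length u                                ≡⟨ sym (length-blocksL n u long-u) ⟩
  length (blocksL (suc n) u) + n          ≡⟨ cong (_+ n) (sym (length-map g (blocksL (suc n) u))) ⟩
  length (L.map g (blocksL (suc n) u)) + n ≡⟨ cong (λ l → length l + n) (sym image) ⟩
  length (blocksL (suc n) v) + n          ≡⟨ length-blocksL n v long-v ⟩
  length v                                ∎

blockImage-aligned : {A B : Set} {N : ℕ} → N ≥ 1 → (g : Vec A N → Vec B N) {m′ : Word A} {m : Word B} →
                     LengthAtLeast N m′ → LengthAtLeast N m → BlockImage N g m′ m → Aligned m′ m
blockImage-aligned {N = suc n} _ g {fin u} {fin v} long-u long-v image =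
  fin (blockImage-length n g u v long-u long-v image)
blockImage-aligned _ g {inf _} {inf _} _ _ _ = inf
blockImage-aligned _ g {bi _}  {bi _}  _ _ _ = bi
blockImage-aligned _ g {fin _} {inf _} _ _ ()
blockImage-aligned _ g {fin _} {bi _}  _ _ ()
blockImage-aligned _ g {inf _} {fin _} _ _ ()
blockImage-aligned _ g {inf _} {bi _}  _ _ ()
blockImage-aligned _ g {bi _}  {fin _} _ _ ()
blockImage-aligned _ g {bi _}  {inf _} _ _ ()

preimage-transfer : {N : ℕ} {Z A W : WordSet} → IsPreimage N Z A →
                    (∀ u → words W u → LengthAtLeast N u) →
                    Dominates (blockSet N A) (blockSet N W) →
                    Dominates (blockSet N W) (blockSet N A) →
                    IsPreimage N Z W
preimage-transfer {N} {Z} {A} {W} (_ , Z≽A , A≽Z) long-W A≽W W≽A =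
    long-W
  , dominates-trans {X = words Z} {Y = blockSet N A} {Z = blockSet N W} Z≽A A≽W
  , dominates-trans {X = blockSet N W} {Y = blockSet N A} {Z = words Z} W≽A A≽Z

module Graph (N : ℕ) (N≥1 : N ≥ 1) (A B : WordSet)
             (g : Vec (Alpha A) N → Vec (Alpha B) N)
             (g-projects : ProjectsOnto g (blockSet N A) (blockSet N B))
             (long-A : ∀ u → words A u → LengthAtLeast N u)
             (long-B : ∀ u → words B u → LengthAtLeast N u) where

  data GraphWord : WordPred (Alpha A × Alpha B) where
    graph : {m′ : Word (Alpha A)} {m : Word (Alpha B)} →
            words A m′ → words B m → BlockImage N g m′ m → GraphWord (zipW m′ m)

  graphSet : WordSet
  graphSet = record { Alpha = Alpha A × Alpha B
                    ; finite = finite-× (finite A) (finite B)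
                    ; words = GraphWord }

  partner : ∀ m′ → words A m′ → ∃[ m ] (words B m × BlockImage N g m′ m)
  partner m′ Am′ with proj₁ g-projects (block N m′) (m′ , Am′ , ≈-refl _)
  ... | _ , (m , Bm , m≈z) , gm′≈z = m , Bm , ≈-trans m≈z (≈-sym gm′≈z)

  ancestor : ∀ m → words B m → ∃[ m′ ] (words A m′ × BlockImage N g m′ m)
  ancestor m Bm with proj₂ g-projects (block N m) (m , Bm , ≈-refl _)
  ... | _ , (m′ , Am′ , m′≈z) , gz≈m = m′ , Am′ , ≈-sym (≈-trans (mapW-cong g m′≈z) gz≈m)

  aligned : {m′ : Word (Alpha A)} {m : Word (Alpha B)} →
            words A m′ → words B m → BlockImage N g m′ m → Aligned m′ m
  aligned {m′} {m} Am′ Bm = blockImage-aligned N≥1 g (long-A m′ Am′) (long-B m Bm)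

  graph-block : {m′ : Word (Alpha A)} {m : Word (Alpha B)} →
                words A m′ → words B m → BlockImage N g m′ m →
                block N (zipW m′ m) ≈ mapW (pairWith g) (block N m′)
  graph-block Am′ Bm image = block-zipW N g (aligned Am′ Bm image) image

  graph-long : ∀ w → GraphWord w → LengthAtLeast N w
  graph-long _ (graph {m′} Am′ Bm image) = zipW-long (aligned Am′ Bm image) (long-A m′ Am′)

  pair-blocks : Dominates (blockSet N A) (blockSet N graphSet)
  pair-blocks = pairWith g , into , onto
    where
    into : ∀ z → blockSet N A z → ∃[ w ] (blockSet N graphSet w × mapW (pairWith g) z ≈ w)
    into z (m′ , Am′ , m′≈z) with partner m′ Am′
    ... | m , Bm , image =
      block N (zipW m′ m) , (zipW m′ m , graph Am′ Bm image , ≈-refl _) ,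
      ≈-trans (mapW-cong (pairWith g) (≈-sym m′≈z)) (≈-sym (graph-block Am′ Bm image))
    onto : ∀ w → blockSet N graphSet w → ∃[ z ] (blockSet N A z × mapW (pairWith g) z ≈ w)
    onto w (_ , graph {m′} Am′ Bm image , zip≈w) =
      block N m′ , (m′ , Am′ , ≈-refl _) , ≈-trans (≈-sym (graph-block Am′ Bm image)) zip≈w

  unpair-graph : {m′ : Word (Alpha A)} {m : Word (Alpha B)} →
                 words A m′ → words B m → BlockImage N g m′ m →
                 mapW (V.map proj₁) (block N (zipW m′ m)) ≈ block N m′
  unpair-graph {m′} Am′ Bm image =
    ≈-trans (mapW-cong (V.map proj₁) (graph-block Am′ Bm image)) (unpair-pair g (block N m′))

  unpair-blocks : Dominates (blockSet N graphSet) (blockSet N A)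
  unpair-blocks = V.map proj₁ , into , onto
    where
    into : ∀ w → blockSet N graphSet w → ∃[ z ] (blockSet N A z × mapW (V.map proj₁) w ≈ z)
    into w (_ , graph {m′} Am′ Bm image , zip≈w) =
      block N m′ , (m′ , Am′ , ≈-refl _) ,
      ≈-trans (mapW-cong (V.map proj₁) (≈-sym zip≈w)) (unpair-graph Am′ Bm image)
    onto : ∀ z → blockSet N A z → ∃[ w ] (blockSet N graphSet w × mapW (V.map proj₁) w ≈ z)
    onto z (m′ , Am′ , m′≈z) with partner m′ Am′
    ... | m , Bm , image =
      block N (zipW m′ m) , (zipW m′ m , graph Am′ Bm image , ≈-refl _) ,
      ≈-trans (unpair-graph Am′ Bm image) m′≈z

  graph≽B : graphSet ≽ B
  graph≽B = proj₂ , into , onto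
    where
    into : ∀ w → GraphWord w → ∃[ m ] (words B m × mapW proj₂ w ≈ m)
    into _ (graph {m = m} Am′ Bm image) = m , Bm , proj₂-zipW (aligned Am′ Bm image)
    onto : ∀ m → words B m → ∃[ w ] (GraphWord w × mapW proj₂ w ≈ m)
    onto m Bm with ancestor m Bm
    ... | m′ , Am′ , image = zipW m′ m , graph Am′ Bm image , proj₂-zipW (aligned Am′ Bm image)

proposition1 : (N : ℕ) → N ≥ 1 → (X Y : WordSet) →
    IsBlockPresentation N X → IsBlockPresentation N Y → X ≽ Y →
    (MX MY : WordSet) → IsMaxPreimage N X MX → IsMaxPreimage N Y MY →
    MX ≽ MY
proposition1 N N≥1 X Y _ _ X≽Y MX MY (MX-pre@(long-MX , _ , MX^≽X) , MX-max) ((long-MY , Y≽MY^ , _) , _) =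
  dominates-trans {X = words MX} {Y = words G.graphSet} {Z = words MY}
    (MX-max G.graphSet graph-preimage) G.graph≽B
  where
  blockMap : Dominates (blockSet N MX) (blockSet N MY)
  blockMap = dominates-trans {X = blockSet N MX} {Y = words Y} {Z = blockSet N MY}
               (dominates-trans {X = blockSet N MX} {Y = words X} {Z = words Y} MX^≽X X≽Y) Y≽MY^

  module G = Graph N N≥1 MX MY (proj₁ blockMap) (proj₂ blockMap) long-MX long-MY

  graph-preimage : IsPreimage N X G.graphSet
  graph-preimage = preimage-transfer {N} {X} {MX} {G.graphSet} MX-pre G.graph-long G.pair-blocks G.unpair-blocks
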